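{- For every $\pi\in S_n$, every alternating cycle of length $\ell\geq 2$ in the cycle graph $G(\pi)$ contains at most $\ell-1$ descents of $\pi$ and at least one descent of $\pi$.
   Context: $\pi\in S_n$ is written $\langle \pi_1\ \cdots\ \pi_n\rangle$, $\pi_i=\pi(i)$, with $\pi_0=0$. The cycle graph $G(\pi)$ is the directed graph on vertices $\pi_0=0,\pi_1,\ldots,\pi_n$ with black arcs $(\pi_i,\pi_{i-1})$ for $1\leq i\leq n$ together with $(\pi_0,\pi_n)$, and grey arcs $(\pi_i,\pi_i+1)$ for the vertices with $\pi_i<n$ together with $(n,0)$. Each vertex has exactly one outgoing and one incoming arc of each colour, so the arc set decomposes uniquely into arc-disjoint alternating cycles (cycles alternating black and grey arcs); the length of an alternating cycle is its number of black arcs. A descent of $\pi$ is a pair $(\pi_{i-1},\pi_i)$ with $\pi_i<\pi_{i-1}$. An alternating cycle $C$ contains the descent $(\pi_{i-1},\pi_i)$ if $(\pi_i,\pi_{i-1})$ is a black arc of $C$. -}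

module Defs where

open import Data.Nat using (ℕ; zero; suc; _<_; _≤_)
open import Data.Fin using (Fin; zero; suc; toℕ; fromℕ; inject₁; lower₁; _≟_)
open import Data.Fin.Permutation using (Permutation′; _⟨$⟩ʳ_; _⟨$⟩ˡ_)
open import Data.List using (List; length; filter; upTo; allFin)
open import Data.List.Relation.Unary.Any using (Any; any?)
open import Data.Product using (_×_)
open import Relation.Binary.PropositionalEquality using (_≡_; _≢_)
open import Relation.Nullary using (Dec; yes; no)
open import Relation.Nullary.Decidable using (_×-dec_)
import Data.Nat as ℕ

-- A permutation π ∈ S_n is given as a permutation of Fin n; the value
-- π_i (for 1 ≤ i ≤ n) is 1 + toℕ (π ⟨$⟩ʳ (i-1)).  Positions and values
-- 0..n of the extended word ⟨0 π_1 ... π_n⟩ are elements of Fin (suc n).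

val : ∀ {n} → Permutation′ n → Fin (suc n) → Fin (suc n)
val π zero    = zero
val π (suc i) = suc (π ⟨$⟩ʳ i)

pos : ∀ {n} → Permutation′ n → Fin (suc n) → Fin (suc n)
pos π zero    = zero
pos π (suc v) = suc (π ⟨$⟩ˡ v)

prevPos : ∀ {n} → Fin (suc n) → Fin (suc n)
prevPos {n} zero = fromℕ n
prevPos (suc i)  = inject₁ i

-- The black arc leaving vertex π_i is (π_i , π_{i-1}) for i ≥ 1, and
-- (π_0 , π_n) for i = 0.
black : ∀ {n} → Permutation′ n → Fin (suc n) → Fin (suc n)
black π v = val π (prevPos (pos π v))

-- The grey arc leaving vertex v is (v , v+1) for v < n, and (n , 0).
grey : ∀ {n} → Fin (suc n) → Fin (suc n)
grey {n} v with fromℕ n ≟ v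
... | yes _  = zero
... | no  ne = suc (lower₁ v λ eq → ne (lemma eq))
  where
  open import Data.Fin.Properties using (toℕ-injective; toℕ-fromℕ)
  open import Relation.Binary.PropositionalEquality using (trans)
  lemma : n ≡ toℕ v → fromℕ n ≡ v
  lemma eq = toℕ-injective (trans (toℕ-fromℕ n) eq)

step : ∀ {n} → Permutation′ n → Fin (suc n) → Fin (suc n)
step π v = grey (black π v)

iter : ∀ {A : Set} → (A → A) → ℕ → A → A
iter f zero    x = x
iter f (suc k) x = f (iter f k x)

-- An alternating cycle of length ℓ through vertex v: starting at v, follow
-- black, grey, black, grey, ...; its black arcs are the black arcs leaving
-- the vertices iter (step π) k v for 0 ≤ k < ℓ, and ℓ is the first return.
record AltCycle {n} (π : Permutation′ n) (v : Fin (suc n)) (ℓ : ℕ) : Set where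
  field
    ℓ-pos    : 1 ≤ ℓ
    closes   : iter (step π) ℓ v ≡ v
    minimal  : ∀ k → 1 ≤ k → k < ℓ → iter (step π) k v ≢ v

-- Descent at position i+1 (i : Fin n): the pair (π_i , π_{i+1}) with
-- π_{i+1} < π_i.
Descent : ∀ {n} → Permutation′ n → Fin n → Set
Descent π i = toℕ (val π (suc i)) < toℕ (val π (inject₁ i))

descent? : ∀ {n} (π : Permutation′ n) (i : Fin n) → Dec (Descent π i)
descent? π i = toℕ (val π (suc i)) ℕ.<? toℕ (val π (inject₁ i))

-- The alternating cycle (v, ℓ) contains the descent (π_{i}, π_{i+1}) iff
-- the black arc (π_{i+1}, π_i) is one of its black arcs, i.e. its tail
-- π_{i+1} is one of iter (step π) k v, k < ℓ.
ContainsArc : ∀ {n} → Permutation′ n → Fin (suc n) → ℕ → Fin n → Set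
ContainsArc π v ℓ i = Any (λ k → iter (step π) k v ≡ val π (suc i)) (upTo ℓ)

containsArc? : ∀ {n} (π : Permutation′ n) v ℓ (i : Fin n) → Dec (ContainsArc π v ℓ i)
containsArc? π v ℓ i = any? (λ k → iter (step π) k v ≟ val π (suc i)) (upTo ℓ)

descentsIn : ∀ {n} → Permutation′ n → Fin (suc n) → ℕ → ℕ
descentsIn π v ℓ =
  length (filter (λ i → descent? π i ×-dec containsArc? π v ℓ i) (allFin _))

-- A nonzero vertex y = π_i is the tail of the black arc (π_i , π_{i-1}), which comes from a
-- descent exactly when y < π_{i-1}; call such y a descent bottom. The black-then-grey step
-- y ↦ π_{i-1} + 1 moves a descent bottom strictly up (unless it wraps round to 0) and moves
-- every other nonzero vertex weakly down without reaching 0. An alternating cycle returns to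
-- its start, so its steps cannot all go up; and if they all went weakly down, the cycle would
-- already be back at its start after one step. So a cycle of length ℓ ≥ 2 passes through
-- between 1 and ℓ - 1 descent bottoms, and these correspond to the descents it contains.
module Submission where

open import Defs
open import Data.Nat using (ℕ; zero; suc; _≤_; _<_; _∸_; z≤n; s≤s)
open import Data.Nat.Properties
  using (_<?_; 0≢1+n; 1+n≢n; ≤-refl; ≤-trans; ≤-antisym; <-irrefl; <-≤-trans; <⇒≤; ≮⇒≥;
         ≤∧≢⇒<; m≤n⇒m≤1+n; m≤n⇒m<n∨m≡n)
open import Data.Product using (_×_; _,_; ∃; proj₁; proj₂)
open import Data.Sum using (_⊎_; inj₁; inj₂)
open import Data.Fin using (Fin; zero; suc; toℕ; fromℕ; fromℕ<; inject₁; punchOut; _≟_)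
open import Data.Fin.Properties
  using (toℕ-injective; toℕ-fromℕ; toℕ-fromℕ<; toℕ-lower₁; toℕ-inject₁; toℕ<n;
         suc-injective; punchOut-injective; injective⇒≤; any?; ¬∀⟶∃¬)
open import Data.Fin.Permutation using (Permutation′; _⟨$⟩ˡ_; inverseˡ; inverseʳ)
open import Data.List using (List; _∷_; length; lookup; filter; allFin)
open import Data.List.Membership.Propositional using (_∈_; find; lose)
open import Data.List.Membership.Propositional.Properties
  using (∈-lookup; ∈-filter⁺; ∈-filter⁻; ∈-upTo⁺; ∈-upTo⁻; ∈-allFin; ∈-length)
open import Data.List.Relation.Unary.All as All using ()
open import Data.List.Relation.Unary.AllPairs using (_∷_)
open import Data.List.Relation.Unary.Unique.Propositional using (Unique)
open import Data.List.Relation.Unary.Unique.Propositional.Properties using (filter⁺; allFin⁺)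
open import Data.Empty using (⊥)
open import Function using (_∘_; id)
open import Relation.Binary.Definitions using (Reflexive; Transitive)
open import Relation.Binary.PropositionalEquality
  using (_≡_; _≢_; refl; sym; trans; cong; subst; module ≡-Reasoning)
open import Relation.Nullary using (¬_; Dec; yes; no; contradiction)
open import Relation.Nullary.Decidable using (_×-dec_)

lookup-injective : ∀ {A : Set} {xs : List A} → Unique xs →
                   ∀ i j → lookup xs i ≡ lookup xs j → i ≡ j
lookup-injective (_ ∷ _)  zero    zero    _ = refl
lookup-injective (x∉ ∷ _) zero    (suc j) e = contradiction e (All.lookup x∉ (∈-lookup j))
lookup-injective (x∉ ∷ _) (suc i) zero    e = contradiction (sym e) (All.lookup x∉ (∈-lookup i))
lookup-injective (_ ∷ u)  (suc i) (suc j) e = cong suc (lookup-injective u i j e)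

length≤-of-injection : ∀ {A : Set} {xs : List A} {m} → Unique xs →
  (f : ∀ {a} → a ∈ xs → Fin m) →
  (∀ {a b} (p : a ∈ xs) (q : b ∈ xs) → f p ≡ f q → a ≡ b) →
  length xs ≤ m
length≤-of-injection u f f-injective =
  injective⇒≤ λ {i} {j} e → lookup-injective u i j (f-injective (∈-lookup i) (∈-lookup j) e)

chain : ∀ {A : Set} (_≼_ : A → A → Set) → Reflexive _≼_ → Transitive _≼_ →
        (s : ℕ → A) → ∀ m → (∀ {k} → k < m → s (suc k) ≼ s k) → s m ≼ s 0
chain _≼_ refl′ trans′ s zero    steps = refl′
chain _≼_ refl′ trans′ s (suc m) steps =
  trans′ (steps {m} ≤-refl) (chain _≼_ refl′ trans′ s m (λ k<m → steps (m≤n⇒m≤1+n k<m)))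

toℕ-grey : ∀ {n} (y : Fin (suc n)) → toℕ y < n → toℕ (grey y) ≡ suc (toℕ y)
toℕ-grey {n} y y<n with fromℕ n ≟ y
... | yes refl = contradiction y<n (<-irrefl (toℕ-fromℕ n))
... | no _     = cong suc (toℕ-lower₁ y _)

grey≡zero⊎toℕ-grey : ∀ {n} (y : Fin (suc n)) → grey y ≡ zero ⊎ toℕ (grey y) ≡ suc (toℕ y)
grey≡zero⊎toℕ-grey {n} y with fromℕ n ≟ y
... | yes _ = inj₁ refl
... | no _  = inj₂ (cong suc (toℕ-lower₁ y _))

-- ≤ on the nonzero vertices with 0 added on top: a ≼-descending walk from a nonzero
-- vertex never reaches 0.
_≼_ : ∀ {n} → Fin (suc n) → Fin (suc n) → Set
y ≼ z = z ≢ zero → y ≢ zero × toℕ y ≤ toℕ z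

≼-refl : ∀ {n} → Reflexive (_≼_ {n})
≼-refl y≢0 = y≢0 , ≤-refl

≼-trans : ∀ {n} → Transitive (_≼_ {n})
≼-trans x≼y y≼z z≢0 with y≼z z≢0
... | y≢0 , y≤z = proj₁ (x≼y y≢0) , ≤-trans (proj₂ (x≼y y≢0)) y≤z

≼-antisym : ∀ {n} {y z : Fin (suc n)} → y ≼ z → z ≼ y → y ≡ z
≼-antisym {y = y} {z = zero} y≼z z≼y with y ≟ zero
... | yes y≡0 = y≡0
... | no  y≢0 = contradiction refl (proj₁ (z≼y y≢0))
≼-antisym {z = suc w} y≼z z≼y with y≼z (λ ())
... | y≢0 , y≤z = toℕ-injective (≤-antisym y≤z (proj₂ (z≼y y≢0)))

module _ {n} (π : Permutation′ n) where

  pos-val : ∀ i → pos π (val π i) ≡ i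
  pos-val zero    = refl
  pos-val (suc i) = cong suc (inverseˡ π)

  val-pos : ∀ y → val π (pos π y) ≡ y
  val-pos zero    = refl
  val-pos (suc y) = cong suc (inverseʳ π)

  val-injective : ∀ {i j} → val π i ≡ val π j → i ≡ j
  val-injective {i} {j} e = trans (sym (pos-val i)) (trans (cong (pos π) e) (pos-val j))

  black-val-suc : ∀ i → black π (val π (suc i)) ≡ val π (inject₁ i)
  black-val-suc i = cong (val π ∘ prevPos) (pos-val (suc i))

  black-irreflexive : ∀ w → black π (suc w) ≢ suc w
  black-irreflexive w e = 1+n≢n (trans (cong toℕ (sym inject₁j≡sucj)) (toℕ-inject₁ j))
    where
    j = π ⟨$⟩ˡ w
    inject₁j≡sucj : inject₁ j ≡ suc j
    inject₁j≡sucj = val-injective (trans e (sym (val-pos (suc w))))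

  DescentBottom : Fin (suc n) → Set
  DescentBottom zero    = ⊥
  DescentBottom (suc w) = toℕ (suc w) < toℕ (black π (suc w))

  descentBottom? : ∀ y → Dec (DescentBottom y)
  descentBottom? zero    = no id
  descentBottom? (suc w) = toℕ (suc w) <? toℕ (black π (suc w))

  DescentBottom-val : ∀ i → DescentBottom (val π (suc i)) ≡ Descent π i
  DescentBottom-val i = cong (λ z → toℕ (val π (suc i)) < toℕ z) (black-val-suc i)

  descentBottom≢zero : ∀ {y} → DescentBottom y → y ≢ zero
  descentBottom≢zero {suc _} _ ()

  step-≼ : ∀ y → ¬ DescentBottom y → step π y ≼ y
  step-≼ zero    _  0≢0 = contradiction refl 0≢0
  step-≼ (suc w) ¬b _   = (λ e → 0≢1+n (trans (sym (cong toℕ e)) toℕ-step)) ,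
                          subst (_≤ toℕ (suc w)) (sym toℕ-step) black<y
    where
    black<y : toℕ (black π (suc w)) < toℕ (suc w)
    black<y = ≤∧≢⇒< (≮⇒≥ ¬b) (black-irreflexive w ∘ toℕ-injective)
    toℕ-step : toℕ (step π (suc w)) ≡ suc (toℕ (black π (suc w)))
    toℕ-step = toℕ-grey (black π (suc w)) (<-≤-trans black<y (toℕ<n w))

  <-step : ∀ y → DescentBottom y → step π y ≢ zero → toℕ y < toℕ (step π y)
  <-step (suc w) b step≢0 with grey≡zero⊎toℕ-grey (black π (suc w))
  ... | inj₁ e = contradiction e step≢0
  ... | inj₂ e = subst (toℕ (suc w) <_) (sym e) (m≤n⇒m≤1+n b)

  descent⇒descentBottom : ∀ {i} → Descent π i → DescentBottom (val π (suc i))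
  descent⇒descentBottom {i} = subst id (sym (DescentBottom-val i))

  descentBottom⇒descent : ∀ {y} → DescentBottom y → ∃ λ i → val π (suc i) ≡ y × Descent π i
  descentBottom⇒descent {suc w} b =
    i , val-pos (suc w) , subst id (DescentBottom-val i) (subst DescentBottom (sym (val-pos (suc w))) b)
    where i = π ⟨$⟩ˡ w

module Orbit {n} {π : Permutation′ n} {v : Fin (suc n)} {m : ℕ} (C : AltCycle π v (suc m)) where
  open AltCycle C

  x : ℕ → Fin (suc n)
  x k = iter (step π) k v

  orbit-has-descentBottom : 1 ≤ m → ∃ λ (k : Fin (suc m)) → DescentBottom π (x (toℕ k))
  orbit-has-descentBottom 1≤m with any? (λ k → descentBottom? π (x (toℕ k)))
  ... | yes found = found
  ... | no none   = contradiction x₁≡v (minimal 1 ≤-refl (s≤s 1≤m))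
    where
    ¬bottom : ∀ {k} → k < suc m → ¬ DescentBottom π (x k)
    ¬bottom {k} k< b = none (fromℕ< k< , subst (DescentBottom π ∘ x) (sym (toℕ-fromℕ< k<)) b)
    v≼x₁ : v ≼ x 1
    v≼x₁ = subst (_≼ x 1) closes
             (chain _≼_ ≼-refl ≼-trans (x ∘ suc) m (λ k<m → step-≼ π _ (¬bottom (s≤s k<m))))
    x₁≡v : x 1 ≡ v
    x₁≡v = ≼-antisym (step-≼ π v (¬bottom (s≤s z≤n))) v≼x₁

  orbit-has-non-descentBottom : ∃ λ (k : Fin (suc m)) → ¬ DescentBottom π (x (toℕ k))
  orbit-has-non-descentBottom = ¬∀⟶∃¬ (suc m) _ (λ k → descentBottom? π (x (toℕ k))) not-all
    where
    not-all : ¬ (∀ k → DescentBottom π (x (toℕ k)))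
    not-all all = <-irrefl (cong toℕ (sym closes)) (<-≤-trans (up (s≤s z≤n)) x₁≤xₘ₊₁)
      where
      bottom : ∀ {k} → k < suc m → DescentBottom π (x k)
      bottom {k} k< = subst (DescentBottom π ∘ x) (toℕ-fromℕ< k<) (all (fromℕ< k<))
      x≢0 : ∀ {k} → k ≤ suc m → x k ≢ zero
      x≢0 k≤ with m≤n⇒m<n∨m≡n k≤
      ... | inj₁ k<   = descentBottom≢zero π (bottom k<)
      ... | inj₂ refl = subst (_≢ zero) (sym closes) (descentBottom≢zero π (bottom (s≤s z≤n)))
      up : ∀ {k} → k < suc m → toℕ (x k) < toℕ (x (suc k))
      up k< = <-step π _ (bottom k<) (x≢0 k<)
      x₁≤xₘ₊₁ : toℕ (x 1) ≤ toℕ (x (suc m))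
      x₁≤xₘ₊₁ = chain (λ a b → toℕ b ≤ toℕ a) ≤-refl (λ p q → ≤-trans q p)
                      (x ∘ suc) m (λ k<m → <⇒≤ (up (s≤s k<m)))

  arc-position : ∀ {i} → ContainsArc π v (suc m) i →
                 ∃ λ (k : Fin (suc m)) → x (toℕ k) ≡ val π (suc i)
  arc-position c with find c
  ... | k , k∈ , e = fromℕ< (∈-upTo⁻ k∈) , trans (cong x (toℕ-fromℕ< (∈-upTo⁻ k∈))) e

  private
    descent-on-cycle? : ∀ i → Dec (Descent π i × ContainsArc π v (suc m) i)
    descent-on-cycle? i = descent? π i ×-dec containsArc? π v (suc m) i

    descents-on-cycle : List (Fin n)
    descents-on-cycle = filter descent-on-cycle? (allFin n)

    on-cycle : ∀ {i} → i ∈ descents-on-cycle → Descent π i × ContainsArc π v (suc m) i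
    on-cycle = proj₂ ∘ ∈-filter⁻ descent-on-cycle? {xs = allFin n}

  descentsIn-≥1 : (∃ λ (k : Fin (suc m)) → DescentBottom π (x (toℕ k))) →
                  1 ≤ descentsIn π v (suc m)
  descentsIn-≥1 (k , b) with descentBottom⇒descent π b
  ... | i , e , d =
    ∈-length (∈-filter⁺ descent-on-cycle? (∈-allFin i) (d , lose (∈-upTo⁺ (toℕ<n k)) (sym e)))

  descentsIn-≤ : (∃ λ (k : Fin (suc m)) → ¬ DescentBottom π (x (toℕ k))) →
                 descentsIn π v (suc m) ≤ m
  descentsIn-≤ (k₀ , ¬b) =
    length≤-of-injection (filter⁺ descent-on-cycle? (allFin⁺ n)) punched-position punched-position-injective
    where
    position : ∀ {i} → i ∈ descents-on-cycle → Fin (suc m)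
    position p = proj₁ (arc-position (proj₂ (on-cycle p)))

    x-position : ∀ {i} (p : i ∈ descents-on-cycle) → x (toℕ (position p)) ≡ val π (suc i)
    x-position p = proj₂ (arc-position (proj₂ (on-cycle p)))

    k₀≢position : ∀ {i} (p : i ∈ descents-on-cycle) → k₀ ≢ position p
    k₀≢position p k₀≡k =
      ¬b (subst (DescentBottom π) (sym (trans (cong (x ∘ toℕ) k₀≡k) (x-position p)))
                (descent⇒descentBottom π (proj₁ (on-cycle p))))

    punched-position : ∀ {i} → i ∈ descents-on-cycle → Fin m
    punched-position p = punchOut (k₀≢position p)

    punched-position-injective : ∀ {i j} (p : i ∈ descents-on-cycle) (q : j ∈ descents-on-cycle) →
                                 punched-position p ≡ punched-position q → i ≡ j
    punched-position-injective {i} {j} p q e = suc-injective (val-injective π (begin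
      val π (suc i)          ≡⟨ x-position p ⟨
      x (toℕ (position p))   ≡⟨ cong (x ∘ toℕ) position-p≡position-q ⟩
      x (toℕ (position q))   ≡⟨ x-position q ⟩
      val π (suc j)          ∎))
      where
      open ≡-Reasoning
      position-p≡position-q : position p ≡ position q
      position-p≡position-q = punchOut-injective (k₀≢position p) (k₀≢position q) e

lemma12 : ∀ (n : ℕ) (π : Permutation′ n) (v : Fin (suc n)) (ℓ : ℕ) →
            AltCycle π v ℓ → 2 ≤ ℓ →
            1 ≤ descentsIn π v ℓ × descentsIn π v ℓ ≤ ℓ ∸ 1
lemma12 n π v (suc m) C (s≤s 1≤m) =
  descentsIn-≥1 (orbit-has-descentBottom 1≤m) , descentsIn-≤ orbit-has-non-descentBottom
  where open Orbit C
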